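{- Let $p>2$ be a prime that is not a Wieferich prime, and let $n$ be a positive integer not divisible by $p$. Then $P(p^2,n)=p\,P(p,n)$ and $P(p^3,n)=p^2P(p,n)$.
   Context: For positive integers $m,n$, let $\mathbf{Z}_m$ be the ring of integers modulo $m$ and define $T:\mathbf{Z}_m^n\to\mathbf{Z}_m^n$ by $T(a_0,\dots,a_{n-1})=(a_0+a_1,a_1+a_2,\dots,a_{n-2}+a_{n-1},a_{n-1}+a_0)$. For $\mathbf{a}\in\mathbf{Z}_m^n$, the cycle length of $(T^k\mathbf{a})_{k\ge0}$ is the smallest positive integer $P$ for which there exists $N$ with $T^{k+P}\mathbf{a}=T^k\mathbf{a}$ for all $k\ge N$. The period $P(m,n)$ is the maximum of these cycle lengths over all $\mathbf{a}\in\mathbf{Z}_m^n$. A prime $p$ is a Wieferich prime if $2^{p-1}\equiv1\pmod{p^2}$. -}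

module Defs where

open import Data.Nat using (ℕ; zero; suc; _+_; _*_; _^_; _≤_; _<_; NonZero)
open import Data.Nat.DivMod using (_%_; m%n<n)
open import Data.Nat.Primality using (Prime)
open import Data.Nat.Divisibility using (_∣_)
open import Data.Fin using (Fin; toℕ; fromℕ<)
open import Data.Product using (Σ; ∃; _×_)
open import Relation.Binary.PropositionalEquality using (_≡_)
open import Relation.Nullary using (¬_)

Vecₘ : ℕ → ℕ → Set
Vecₘ m n = Fin n → Fin m

red : (m : ℕ) → .{{_ : NonZero m}} → ℕ → Fin m
red m x = fromℕ< (m%n<n x m)

nextIx : (n : ℕ) → Fin n → Fin n
nextIx (suc n) i = red (suc n) (suc (toℕ i))

T : (m : ℕ) → .{{_ : NonZero m}} → (n : ℕ) → Vecₘ m n → Vecₘ m n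
T m n a i = red m (toℕ (a i) + toℕ (a (nextIx n i)))

Tˢ : (m : ℕ) → .{{_ : NonZero m}} → (n : ℕ) → ℕ → Vecₘ m n → Vecₘ m n
Tˢ m n zero a = a
Tˢ m n (suc k) a = T m n (Tˢ m n k a)

_≗ᵥ_ : {m n : ℕ} → Vecₘ m n → Vecₘ m n → Set
a ≗ᵥ b = ∀ i → a i ≡ b i

IsEventualPeriod : (m : ℕ) → .{{_ : NonZero m}} → (n : ℕ) → Vecₘ m n → ℕ → Set
IsEventualPeriod m n a P =
  Σ ℕ λ N → ∀ k → N ≤ k → Tˢ m n (k + P) a ≗ᵥ Tˢ m n k a

IsCycleLength : (m : ℕ) → .{{_ : NonZero m}} → (n : ℕ) → Vecₘ m n → ℕ → Set
IsCycleLength m n a P =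
  (0 < P) × IsEventualPeriod m n a P
  × (∀ Q → 0 < Q → Q < P → ¬ IsEventualPeriod m n a Q)

IsPeriod : (m : ℕ) → .{{_ : NonZero m}} → (n : ℕ) → ℕ → Set
IsPeriod m n P =
  (Σ (Vecₘ m n) λ a → IsCycleLength m n a P)
  × (∀ a Q → IsCycleLength m n a Q → Q ≤ P)

-- Wieferich prime: 2^(p-1) ≡ 1 (mod p^2), stated as p^2 ∣ 2^(p-1) - 1,
-- written multiplication-free: 2^(p-1) % p^2 ≡ 1 % p^2 for p ≥ 1.
IsWieferich : (p : ℕ) → .{{_ : NonZero p}} → Set
IsWieferich (suc q) = (2 ^ q) % (suc q * suc q) ≡ 1 % (suc q * suc q)

{-# OPTIONS --safe #-}
-- Lift the Ducci map to ℕ-valued vectors, where it is linear: T^k α = Σ_j (k C j) α(· + j).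
-- Modulo a prime p this gives T^(p^d) ≡ T when p^d ≡ 1 (mod n), so every orbit modulo p is
-- eventually periodic with period p^d − 1. Since every vector is a combination of cyclic shifts of
-- the unit vector δ, an eventual period of δ is one of every orbit; hence the maximal cycle length P
-- is the cycle length of δ, and P ∣ p^d − 1 gives p ∤ P. A period Q modulo p^k lifts to the period
-- pQ modulo p^(k+1): the error term of one period, accumulated over p periods, is divisible by p.
-- Conversely the entries of T^k δ sum to 2^k, so a period Q of δ modulo p² (resp. p³) satisfies
-- 2^Q ≡ 1, which for a non-Wieferich prime forces p ∣ Q (resp. p² ∣ Q); with P ∣ Q and p ∤ P this
-- shows that δ has cycle length pP (resp. p²P), the largest possible.
module Submission where

open import Defs
open import Data.Nat
open import Data.Nat.Properties
open import Data.Nat.DivMod hiding (_mod_)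
open import Data.Nat.Divisibility
open import Data.Nat.GCD using (gcd; gcd[m,n]∣m; gcd[m,n]∣n; gcd-GCD; module Bézout)
open import Data.Nat.Coprimality as Coprime using (Coprime; coprime-divisor)
open import Data.Nat.Primality
open import Data.Product
open import Data.Sum using (inj₁; inj₂)
open import Data.Empty using (⊥-elim)
open import Relation.Nullary
open import Relation.Binary.PropositionalEquality
open import Relation.Binary.Bundles using (Setoid)
open import Relation.Binary.Structures using (IsEquivalence)
import Relation.Binary.Reasoning.Setoid as SetoidReasoning
open import Relation.Binary.Definitions using (Decidable)
import Relation.Unary as Unary
open import Data.Nat.Induction using (<-rec)
open import Data.Nat.Combinatorics using (_C_; nCn≡1; nC1≡n; nCk+nC[k+1]≡[n+1]C[k+1]; k>n⇒nCk≡0)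
open import Data.Nat.Tactic.RingSolver using (solve-∀)
open import Data.Fin using (Fin; toℕ; inject₁; fromℕ)
import Data.Fin.Properties as Fin
open import Algebra.Properties.Semiring.Sum +-*-semiring using (sum; sum-syntax; sum-cong-≗; ∑-distrib-+; sum-init-last; sum-replicate-zero; sum-remove)
import Function.Endo.Propositional as Endo
import Algebra.Properties.Monoid.Mult as MonoidMult
open import Data.Vec.Functional using (removeAt)
open import Function using (_∘_)

infix 4 _≡_mod_
record _≡_mod_ (x y M : ℕ) .{{_ : NonZero M}} : Set where
  constructor mod-≡
  field %-≡ : x % M ≡ y % M
open _≡_mod_ public

module _ {M : ℕ} .{{_ : NonZero M}} where

  ≡-mod-isEquivalence : IsEquivalence (λ x y → x ≡ y mod M)
  ≡-mod-isEquivalence = record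
    { refl  = mod-≡ refl
    ; sym   = λ (mod-≡ e) → mod-≡ (sym e)
    ; trans = λ (mod-≡ e) (mod-≡ f) → mod-≡ (trans e f)
    }

  ≡-mod-setoid : Setoid _ _
  ≡-mod-setoid = record { isEquivalence = ≡-mod-isEquivalence }

  open IsEquivalence ≡-mod-isEquivalence public using ()
    renaming (refl to ≡-mod-refl; sym to ≡-mod-sym; trans to ≡-mod-trans)

  ≡⇒≡-mod : ∀ {x y} → x ≡ y → x ≡ y mod M
  ≡⇒≡-mod refl = ≡-mod-refl

  +-cong-mod : ∀ {x y u v} → x ≡ y mod M → u ≡ v mod M → x + u ≡ y + v mod M
  +-cong-mod {x} {y} {u} {v} (mod-≡ e) (mod-≡ f) = mod-≡ (begin
    (x + u) % M           ≡⟨ %-distribˡ-+ x u M ⟩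
    (x % M + u % M) % M   ≡⟨ cong₂ (λ a b → (a + b) % M) e f ⟩
    (y % M + v % M) % M   ≡⟨ %-distribˡ-+ y v M ⟨
    (y + v) % M           ∎)
    where open ≡-Reasoning

  *-cong-mod : ∀ {x y u v} → x ≡ y mod M → u ≡ v mod M → x * u ≡ y * v mod M
  *-cong-mod {x} {y} {u} {v} (mod-≡ e) (mod-≡ f) = mod-≡ (begin
    (x * u) % M             ≡⟨ %-distribˡ-* x u M ⟩
    (x % M * (u % M)) % M   ≡⟨ cong₂ (λ a b → (a * b) % M) e f ⟩
    (y % M * (v % M)) % M   ≡⟨ %-distribˡ-* y v M ⟨
    (y * v) % M             ∎)
    where open ≡-Reasoning

  ^-cong-mod : ∀ {x y} k → x ≡ y mod M → x ^ k ≡ y ^ k mod M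
  ^-cong-mod zero    e = ≡-mod-refl
  ^-cong-mod (suc k) e = *-cong-mod e (^-cong-mod k e)

  +-*-≡-mod : ∀ x a → x + M * a ≡ x mod M
  +-*-≡-mod x a = mod-≡ (%-remove-+ʳ x (m∣m*n a))

  ∣⇒≡0-mod : ∀ {x} → M ∣ x → x ≡ 0 mod M
  ∣⇒≡0-mod {x} M∣x = mod-≡ (trans (n∣m⇒m%n≡0 x M M∣x) (sym (n∣m⇒m%n≡0 0 M (M ∣0))))

  ≡0-mod⇒∣ : ∀ {x} → x ≡ 0 mod M → M ∣ x
  ≡0-mod⇒∣ {x} (mod-≡ e) = m%n≡0⇒n∣m x M (trans e (n∣m⇒m%n≡0 0 M (M ∣0)))

  ≡-mod⇒∣∸ : ∀ {x y} → x ≡ y mod M → M ∣ x ∸ y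
  ≡-mod⇒∣∸ {x} {y} (mod-≡ e) = subst (M ∣_) (sym x∸y≡) (n∣m*n (x / M ∸ y / M))
    where
    open ≡-Reasoning
    x∸y≡ : x ∸ y ≡ (x / M ∸ y / M) * M
    x∸y≡ = begin
      x ∸ y                                   ≡⟨ cong₂ _∸_ (m≡m%n+[m/n]*n x M) (m≡m%n+[m/n]*n y M) ⟩
      x % M + x / M * M ∸ (y % M + y / M * M) ≡⟨ cong (λ r → x % M + x / M * M ∸ (r + y / M * M)) e ⟨
      x % M + x / M * M ∸ (x % M + y / M * M) ≡⟨ [m+n]∸[m+o]≡n∸o (x % M) _ _ ⟩
      x / M * M ∸ y / M * M                   ≡⟨ *-distribʳ-∸ M (x / M) (y / M) ⟨
      (x / M ∸ y / M) * M                     ∎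

  ∣∸⇒≡-mod : ∀ {x y} → y ≤ x → M ∣ x ∸ y → x ≡ y mod M
  ∣∸⇒≡-mod {x} {y} y≤x (divides c x∸y≡c*M) = mod-≡ (begin
    x % M                  ≡⟨ cong (_% M) (m+[n∸m]≡n y≤x) ⟨
    (y + (x ∸ y)) % M      ≡⟨ %-remove-+ʳ y (divides c x∸y≡c*M) ⟩
    y % M                  ∎)
    where open ≡-Reasoning

  ≡-mod⇒quotients : ∀ {x y} → x ≡ y mod M → x + M * (y / M) ≡ y + M * (x / M)
  ≡-mod⇒quotients {x} {y} (mod-≡ e) = begin
    x + M * (y / M)                   ≡⟨ cong₂ _+_ (m≡m%n+[m/n]*n x M) (*-comm M (y / M)) ⟩
    x % M + x / M * M + y / M * M     ≡⟨ cong (λ r → r + x / M * M + y / M * M) e ⟩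
    y % M + x / M * M + y / M * M     ≡⟨ +-assoc (y % M) _ _ ⟩
    y % M + (x / M * M + y / M * M)   ≡⟨ cong (y % M +_) (+-comm (x / M * M) _) ⟩
    y % M + (y / M * M + x / M * M)   ≡⟨ +-assoc (y % M) _ _ ⟨
    y % M + y / M * M + x / M * M     ≡⟨ cong₂ _+_ (m≡m%n+[m/n]*n y M) (*-comm M (x / M)) ⟨
    y + M * (x / M)                   ∎
    where open ≡-Reasoning

  quotients⇒≡-mod : ∀ {x y a b} → x + M * a ≡ y + M * b → x ≡ y mod M
  quotients⇒≡-mod {x} {y} {a} {b} e = begin
    x          ≈⟨ +-*-≡-mod x a ⟨
    x + M * a  ≡⟨ e ⟩
    y + M * b  ≈⟨ +-*-≡-mod y b ⟩
    y          ∎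
    where open SetoidReasoning ≡-mod-setoid

  *-cancelˡ-mod : ∀ {c x y} → Coprime M c → c * x ≡ c * y mod M → x ≡ y mod M
  *-cancelˡ-mod {c} {x} {y} M⊥c cx≡cy with ≤-total y x
  ... | inj₁ y≤x = ∣∸⇒≡-mod y≤x
    (coprime-divisor M⊥c (subst (M ∣_) (sym (*-distribˡ-∸ c x y)) (≡-mod⇒∣∸ cx≡cy)))
  ... | inj₂ x≤y = ≡-mod-sym (∣∸⇒≡-mod x≤y
    (coprime-divisor M⊥c (subst (M ∣_) (sym (*-distribˡ-∸ c y x)) (≡-mod⇒∣∸ (≡-mod-sym cx≡cy)))))

  ^-*-cancelˡ-mod : ∀ {c x y} k → Coprime M c → c ^ k * x ≡ c ^ k * y mod M → x ≡ y mod M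
  ^-*-cancelˡ-mod {c} {x} {y} zero    M⊥c e = subst₂ (λ u v → u ≡ v mod M) (+-identityʳ x) (+-identityʳ y) e
  ^-*-cancelˡ-mod {c} {x} {y} (suc k) M⊥c e = ^-*-cancelˡ-mod k M⊥c (*-cancelˡ-mod M⊥c
    (subst₂ (λ u v → u ≡ v mod M) (*-assoc c (c ^ k) x) (*-assoc c (c ^ k) y) e))

≡-mod-∣-weaken : ∀ {M D x y} .{{_ : NonZero M}} .{{_ : NonZero D}} → D ∣ M → x ≡ y mod M → x ≡ y mod D
≡-mod-∣-weaken {M} {D} {x} {y} D∣M (mod-≡ e) = mod-≡ (begin
  x % D      ≡⟨ m∣n⇒o%n%m≡o%m D M x D∣M ⟨
  x % M % D  ≡⟨ cong (_% D) e ⟩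
  y % M % D  ≡⟨ m∣n⇒o%n%m≡o%m D M y D∣M ⟩
  y % D      ∎)
  where open ≡-Reasoning

toℕ-red : ∀ m .{{_ : NonZero m}} x → toℕ (red m x) ≡ x mod m
toℕ-red m x = mod-≡ (trans (cong (_% m) (Fin.toℕ-fromℕ< (m%n<n x m))) (m%n%n≡m%n x m))

toℕ-≡-mod⇒≡ : ∀ {m} .{{_ : NonZero m}} {j k : Fin m} → toℕ j ≡ toℕ k mod m → j ≡ k
toℕ-≡-mod⇒≡ {m} {j} {k} (mod-≡ e) =
  Fin.toℕ-injective (trans (sym (m<n⇒m%n≡m (Fin.toℕ<n j))) (trans e (m<n⇒m%n≡m (Fin.toℕ<n k))))

module SubtractiveClosure {ℓ}
  (S : ℕ → Set ℓ)
  (*-closed : ∀ c {x} → S x → S (c * x))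
  (∸-closed : ∀ {x y} → S x → S y → y ≤ x → S (x ∸ y))
  where

  gcd-closed : ∀ {x y} → S x → S y → S (gcd x y)
  gcd-closed {x} {y} Sx Sy with Bézout.identity (gcd-GCD x y)
  ... | Bézout.+- a b eq = subst S (trans (cong (_∸ b * y) (sym eq)) (m+n∸n≡m _ (b * y)))
    (∸-closed (*-closed a Sx) (*-closed b Sy) (subst (b * y ≤_) eq (m≤n+m (b * y) _)))
  ... | Bézout.-+ a b eq = subst S (trans (cong (_∸ a * x) (sym eq)) (m+n∸n≡m _ (a * x)))
    (∸-closed (*-closed b Sy) (*-closed a Sx) (subst (a * x ≤_) eq (m≤n+m (a * x) _)))

  least-∣ : ∀ {L} → 0 < L → S L → (∀ {Q} → 0 < Q → Q < L → ¬ S Q) → ∀ {Q} → 0 < Q → S Q → L ∣ Q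
  least-∣ {L} 0<L SL minimal {Q} 0<Q SQ with m≤n⇒m<n∨m≡n (∣⇒≤ {{>-nonZero 0<L}} (gcd[m,n]∣m L Q))
  ... | inj₂ g≡L = subst (_∣ Q) g≡L (gcd[m,n]∣n L Q)
  ... | inj₁ g<L = ⊥-elim (minimal 0<g g<L (gcd-closed SL SQ))
    where
    0<g : 0 < gcd L Q
    0<g with gcd L Q | gcd[m,n]∣n L Q
    ... | zero  | 0∣Q = ⊥-elim (<⇒≢ 0<Q (sym (0∣⇒≡0 0∣Q)))
    ... | suc _ | _   = z<s

least-witness : ∀ {ℓ} {P : ℕ → Set ℓ} → Unary.Decidable P → ∀ {k} → P k → ∃[ L ] P L × (∀ {j} → j < L → ¬ P j)
least-witness {P = P} P? {k} = <-rec (λ k → P k → ∃[ L ] P L × (∀ {j} → j < L → ¬ P j)) search k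
  where
  search : ∀ k → (∀ {j} → j < k → P j → ∃[ L ] P L × (∀ {i} → i < L → ¬ P i)) →
           P k → ∃[ L ] P L × (∀ {i} → i < L → ¬ P i)
  search k rec Pk with anyUpTo? P? k
  ... | yes (j , j<k , Pj) = rec j<k Pj
  ... | no none            = k , Pk , λ j<k Pj → none (_ , j<k , Pj)

module EventualPeriods {a ℓ} (A : Setoid a ℓ) (s : ℕ → Setoid.Carrier A)
  (suc-cong : ∀ {j k} → Setoid._≈_ A (s j) (s k) → Setoid._≈_ A (s (suc j)) (s (suc k)))
  where

  open Setoid A using (_≈_; reflexive)
  open SetoidReasoning A

  PeriodicFrom : ℕ → ℕ → Set ℓ
  PeriodicFrom K Q = ∀ k → K ≤ k → s (k + Q) ≈ s k

  EventualPeriod : ℕ → Set ℓ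
  EventualPeriod Q = Σ ℕ λ N → PeriodicFrom N Q

  CycleLength : ℕ → Set ℓ
  CycleLength L = (0 < L) × EventualPeriod L × (∀ Q → 0 < Q → Q < L → ¬ EventualPeriod Q)

  shift-cong : ∀ m {j k} → s j ≈ s k → s (m + j) ≈ s (m + k)
  shift-cong zero    e = e
  shift-cong (suc m) e = suc-cong (shift-cong m e)

  returns⇒periodicFrom : ∀ {K Q} → s (K + Q) ≈ s K → PeriodicFrom K Q
  returns⇒periodicFrom {K} {Q} e k K≤k = begin
    s (k + Q)             ≡⟨ cong s k+Q≡ ⟩
    s (k ∸ K + (K + Q))   ≈⟨ shift-cong (k ∸ K) e ⟩
    s (k ∸ K + K)         ≡⟨ cong s (m∸n+n≡m K≤k) ⟩
    s k                   ∎
    where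
    k+Q≡ : k + Q ≡ k ∸ K + (K + Q)
    k+Q≡ = trans (cong (_+ Q) (sym (m∸n+n≡m K≤k))) (+-assoc (k ∸ K) K Q)

  periodicFrom-* : ∀ {K Q} c → PeriodicFrom K Q → PeriodicFrom K (c * Q)
  periodicFrom-* {K} {Q} zero    h k K≤k = reflexive (cong s (+-identityʳ k))
  periodicFrom-* {K} {Q} (suc c) h k K≤k = begin
    s (k + (Q + c * Q))   ≡⟨ cong s (+-assoc k Q (c * Q)) ⟨
    s (k + Q + c * Q)     ≈⟨ periodicFrom-* c h (k + Q) (≤-trans K≤k (m≤m+n k Q)) ⟩
    s (k + Q)             ≈⟨ h k K≤k ⟩
    s k                   ∎

  periodicFrom-∸ : ∀ {K Q R} → PeriodicFrom K Q → PeriodicFrom K R → R ≤ Q → PeriodicFrom K (Q ∸ R)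
  periodicFrom-∸ {K} {Q} {R} hQ hR R≤Q k K≤k = begin
    s (k + (Q ∸ R))       ≈⟨ hR (k + (Q ∸ R)) (≤-trans K≤k (m≤m+n k _)) ⟨
    s (k + (Q ∸ R) + R)   ≡⟨ cong s (trans (+-assoc k (Q ∸ R) R) (cong (k +_) (m∸n+n≡m R≤Q))) ⟩
    s (k + Q)             ≈⟨ hQ k K≤k ⟩
    s k                   ∎

  periodicFrom-mono : ∀ {K K' Q} → K ≤ K' → PeriodicFrom K Q → PeriodicFrom K' Q
  periodicFrom-mono K≤K' h k K'≤k = h k (≤-trans K≤K' K'≤k)

  eventualPeriod-* : ∀ c {Q} → EventualPeriod Q → EventualPeriod (c * Q)
  eventualPeriod-* c (N , h) = N , periodicFrom-* c h

  eventualPeriod-∸ : ∀ {Q R} → EventualPeriod Q → EventualPeriod R → R ≤ Q → EventualPeriod (Q ∸ R)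
  eventualPeriod-∸ (N , hQ) (M , hR) R≤Q = N + M ,
    periodicFrom-∸ (periodicFrom-mono (m≤m+n N M) hQ) (periodicFrom-mono (m≤n+m M N) hR) R≤Q

  open SubtractiveClosure EventualPeriod eventualPeriod-* eventualPeriod-∸

  cycleLength-∣ : ∀ {L Q} → CycleLength L → 0 < Q → EventualPeriod Q → L ∣ Q
  cycleLength-∣ (0<L , pL , minimal) = least-∣ 0<L pL (minimal _)

  -- Move k out by N·E, past the point N from which Q is known to be a period.
  eventualPeriod⇒periodicFrom : ∀ {K E Q} → 0 < E → PeriodicFrom K E → EventualPeriod Q → PeriodicFrom K Q
  eventualPeriod⇒periodicFrom {K} {E} {Q} 0<E hE (N , hQ) k K≤k = begin
    s (k + Q)             ≈⟨ periodicFrom-* N hE (k + Q) (≤-trans K≤k (m≤m+n k Q)) ⟨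
    s (k + Q + N * E)     ≡⟨ cong s (trans (+-assoc k Q _) (trans (cong (k +_) (+-comm Q _)) (sym (+-assoc k _ Q)))) ⟩
    s (k + N * E + Q)     ≈⟨ hQ (k + N * E) (≤-trans N≤N*E (m≤n+m _ k)) ⟩
    s (k + N * E)         ≈⟨ periodicFrom-* N hE k K≤k ⟩
    s k                   ∎
    where
    N≤N*E : N ≤ N * E
    N≤N*E = subst (_≤ N * E) (*-identityʳ N) (*-monoʳ-≤ N 0<E)

  cycleLength-exists : Decidable _≈_ → ∀ {K E} → 0 < E → PeriodicFrom K E → ∃ CycleLength
  cycleLength-exists _≈?_ {K} {E} 0<E hE with least-witness returns? (0<E , hE K ≤-refl)
    where
    returns? : Unary.Decidable (λ Q → 0 < Q × s (K + Q) ≈ s K)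
    returns? Q = (0 <? Q) ×-dec (s (K + Q) ≈? s K)
  ... | L , (0<L , returnsL) , minimal = L , 0<L , (K , returns⇒periodicFrom returnsL) ,
    λ Q 0<Q Q<L pQ → minimal Q<L (0<Q , eventualPeriod⇒periodicFrom 0<E hE pQ K ≤-refl)

∑-cong-mod : ∀ {n M} .{{_ : NonZero M}} {f g : Fin n → ℕ} → (∀ i → f i ≡ g i mod M) → sum f ≡ sum g mod M
∑-cong-mod {zero}  f≡g = ≡-mod-refl
∑-cong-mod {suc n} f≡g = +-cong-mod (f≡g Fin.zero) (∑-cong-mod (f≡g ∘ Fin.suc))

[1+j]*[1+k]C[1+j]≡[1+k]*kCj : ∀ k j → suc j * (suc k C suc j) ≡ suc k * (k C j)
[1+j]*[1+k]C[1+j]≡[1+k]*kCj zero    zero    = refl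
[1+j]*[1+k]C[1+j]≡[1+k]*kCj zero    (suc j) = trans (cong (suc (suc j) *_) (k>n⇒nCk≡0 {1} {suc (suc j)} (s<s z<s))) (*-zeroʳ (suc (suc j)))
[1+j]*[1+k]C[1+j]≡[1+k]*kCj (suc k) zero    = trans (+-identityʳ _) (trans (nC1≡n (suc (suc k))) (sym (*-identityʳ (suc (suc k)))))
[1+j]*[1+k]C[1+j]≡[1+k]*kCj (suc k) (suc j) = begin
  suc (suc j) * (k+2 C (suc (suc j)))
    ≡⟨ cong (suc (suc j) *_) (nCk+nC[k+1]≡[n+1]C[k+1] (suc k) (suc j)) ⟨
  suc (suc j) * (k+1 C suc j + k+1 C (suc (suc j)))
    ≡⟨ *-distribˡ-+ (suc (suc j)) (k+1 C suc j) _ ⟩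
  k+1 C suc j + suc j * (k+1 C suc j) + suc (suc j) * (k+1 C (suc (suc j)))
    ≡⟨ cong₂ (λ a b → k+1 C suc j + a + b) ([1+j]*[1+k]C[1+j]≡[1+k]*kCj k j) ([1+j]*[1+k]C[1+j]≡[1+k]*kCj k (suc j)) ⟩
  k+1 C suc j + k+1 * (k C j) + k+1 * (k C suc j)
    ≡⟨ +-assoc (k+1 C suc j) _ _ ⟩
  k+1 C suc j + (k+1 * (k C j) + k+1 * (k C suc j))
    ≡⟨ cong (k+1 C suc j +_) (*-distribˡ-+ k+1 (k C j) _) ⟨
  k+1 C suc j + k+1 * (k C j + k C suc j)
    ≡⟨ cong (λ c → k+1 C suc j + k+1 * c) (nCk+nC[k+1]≡[n+1]C[k+1] k j) ⟩
  suc k+1 * (k+1 C suc j)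
    ∎
  where
  open ≡-Reasoning
  k+1 = suc k
  k+2 = suc (suc k)

prime∣pCj : ∀ {p j} → Prime p → 0 < j → j < p → p ∣ p C j
prime∣pCj {suc k} {suc j} p-prime _ j<p
  with euclidsLemma (suc j) (suc k C suc j) p-prime
         (subst (suc k ∣_) (sym ([1+j]*[1+k]C[1+j]≡[1+k]*kCj k j)) (m∣m*n (k C j)))
... | inj₁ p∣j+1 = ⊥-elim (<⇒≱ j<p (∣⇒≤ p∣j+1))
... | inj₂ p∣pCj = p∣pCj

binomialSum : ℕ → (ℕ → ℕ) → ℕ
binomialSum k x = ∑[ j < suc k ] ((k C toℕ j) * x (toℕ j))

∑-kC[1+j]-init : ∀ k (y : ℕ → ℕ) → ∑[ j < suc k ] ((k C suc (toℕ j)) * y (toℕ j)) ≡ ∑[ j < k ] ((k C suc (toℕ j)) * y (toℕ j))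
∑-kC[1+j]-init k y = begin
  ∑[ j < suc k ] ((k C suc (toℕ j)) * y (toℕ j))
    ≡⟨ sum-init-last {k} (λ j → (k C suc (toℕ j)) * y (toℕ j)) ⟩
  ∑[ j < k ] ((k C suc (toℕ (inject₁ j))) * y (toℕ (inject₁ j))) + (k C suc (toℕ (fromℕ k))) * y (toℕ (fromℕ k))
    ≡⟨ cong₂ _+_ (sum-cong-≗ {k} λ j → cong (λ i → (k C suc i) * y i) (Fin.toℕ-inject₁ j))
                 (cong (λ i → (k C suc i) * y i) (Fin.toℕ-fromℕ k)) ⟩
  ∑[ j < k ] ((k C suc (toℕ j)) * y (toℕ j)) + (k C suc k) * y k
    ≡⟨ cong (λ c → ∑[ j < k ] ((k C suc (toℕ j)) * y (toℕ j)) + c * y k) (k>n⇒nCk≡0 (n<1+n k)) ⟩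
  ∑[ j < k ] ((k C suc (toℕ j)) * y (toℕ j)) + 0
    ≡⟨ +-identityʳ _ ⟩
  ∑[ j < k ] ((k C suc (toℕ j)) * y (toℕ j))
    ∎
  where open ≡-Reasoning

binomialSum-suc : ∀ k x → binomialSum (suc k) x ≡ binomialSum k x + binomialSum k (x ∘ suc)
binomialSum-suc k x = begin
  1 * x 0 + ∑[ j < suc k ] ((suc k C suc (toℕ j)) * x (suc (toℕ j)))
    ≡⟨ cong (1 * x 0 +_) (sum-cong-≗ {suc k} λ j → cong (_* x (suc (toℕ j))) (nCk+nC[k+1]≡[n+1]C[k+1] k (toℕ j))) ⟨
  1 * x 0 + ∑[ j < suc k ] ((k C toℕ j + k C suc (toℕ j)) * x (suc (toℕ j)))
    ≡⟨ cong (1 * x 0 +_) (sum-cong-≗ {suc k} λ j → *-distribʳ-+ (x (suc (toℕ j))) (k C toℕ j) (k C suc (toℕ j))) ⟩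
  1 * x 0 + ∑[ j < suc k ] ((k C toℕ j) * x (suc (toℕ j)) + (k C suc (toℕ j)) * x (suc (toℕ j)))
    ≡⟨ cong (1 * x 0 +_) (∑-distrib-+ {suc k} (λ j → (k C toℕ j) * x (suc (toℕ j))) (λ j → (k C suc (toℕ j)) * x (suc (toℕ j)))) ⟩
  1 * x 0 + (binomialSum k (x ∘ suc) + ∑[ j < suc k ] ((k C suc (toℕ j)) * x (suc (toℕ j))))
    ≡⟨ cong (λ t → 1 * x 0 + (binomialSum k (x ∘ suc) + t)) (∑-kC[1+j]-init k (x ∘ suc)) ⟩
  1 * x 0 + (binomialSum k (x ∘ suc) + inner)
    ≡⟨ cong (1 * x 0 +_) (+-comm (binomialSum k (x ∘ suc)) inner) ⟩
  1 * x 0 + (inner + binomialSum k (x ∘ suc))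
    ≡⟨ +-assoc (1 * x 0) inner _ ⟨
  binomialSum k x + binomialSum k (x ∘ suc)
    ∎
  where
  open ≡-Reasoning
  inner : ℕ
  inner = ∑[ j < k ] ((k C suc (toℕ j)) * x (suc (toℕ j)))

binomialSum-1 : ∀ k → binomialSum k (λ _ → 1) ≡ 2 ^ k
binomialSum-1 zero    = refl
binomialSum-1 (suc k) = begin
  binomialSum (suc k) (λ _ → 1)               ≡⟨ binomialSum-suc k (λ _ → 1) ⟩
  binomialSum k (λ _ → 1) + binomialSum k (λ _ → 1) ≡⟨ cong₂ _+_ (binomialSum-1 k) (binomialSum-1 k) ⟩
  2 ^ k + 2 ^ k                                ≡⟨ cong (2 ^ k +_) (+-identityʳ (2 ^ k)) ⟨
  2 ^ suc k                                    ∎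
  where open ≡-Reasoning

-- Frobenius: the inner binomial coefficients of a prime row vanish modulo p.
binomialSum-prime : ∀ {p} .{{_ : NonZero p}} → Prime p → ∀ x → binomialSum p x ≡ x 0 + x p mod p
binomialSum-prime {suc q} p-prime x = begin
  1 * x 0 + ∑[ j < suc q ] f j                       ≡⟨ cong₂ _+_ (*-identityˡ (x 0)) (sum-init-last f) ⟩
  x 0 + (∑[ j < q ] f (inject₁ j) + f (fromℕ q))    ≈⟨ +-cong-mod (≡-mod-refl {x = x 0}) (+-cong-mod inner≡0 ≡-mod-refl) ⟩
  x 0 + (0 + f (fromℕ q))                           ≡⟨ cong (λ i → x 0 + (suc q C suc i) * x (suc i)) (Fin.toℕ-fromℕ q) ⟩
  x 0 + (suc q C suc q) * x (suc q)                 ≡⟨ cong (λ c → x 0 + c * x (suc q)) (nCn≡1 (suc q)) ⟩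
  x 0 + 1 * x (suc q)                               ≡⟨ cong (x 0 +_) (*-identityˡ (x (suc q))) ⟩
  x 0 + x (suc q)                                   ∎
  where
  open SetoidReasoning ≡-mod-setoid
  f : Fin (suc q) → ℕ
  f j = (suc q C suc (toℕ j)) * x (suc (toℕ j))
  inner≡0 : ∑[ j < q ] f (inject₁ j) ≡ 0 mod suc q
  inner≡0 = ≡-mod-trans
    (∑-cong-mod {q} λ j → ∣⇒≡0-mod (∣m⇒∣m*n _ (prime∣pCj p-prime z<s
      (s<s (subst (_< q) (sym (Fin.toℕ-inject₁ j)) (Fin.toℕ<n j))))))
    (≡⇒≡-mod (sum-replicate-zero q))

prime∤⇒coprime : ∀ {p m} → Prime p → ¬ p ∣ m → Coprime p m
prime∤⇒coprime p-prime p∤m (d∣p , d∣m) with prime⇒irreducible p-prime d∣p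
... | inj₁ d≡1  = d≡1
... | inj₂ refl = ⊥-elim (p∤m d∣m)

prime∣^⇒∣ : ∀ {p m} k → Prime p → p ∣ m ^ k → p ∣ m
prime∣^⇒∣ {p} zero    p-prime p∣1 = ⊥-elim (<⇒≢ (nonTrivial⇒n>1 p {{prime⇒nonTrivial p-prime}}) (sym (∣1⇒≡1 p∣1)))
prime∣^⇒∣ {p} {m} (suc k) p-prime p∣m^k+1 with euclidsLemma m (m ^ k) p-prime p∣m^k+1
... | inj₁ p∣m   = p∣m
... | inj₂ p∣m^k = prime∣^⇒∣ k p-prime p∣m^k

∣m*p*p⇒∣m*p : ∀ {p g} m → Prime p → g ∣ m * p * p → ¬ p * p ∣ g → g ∣ m * p
∣m*p*p⇒∣m*p {p} {g} m p-prime g∣mpp p²∤g with p ∣? g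
... | no  p∤g = coprime-divisor (Coprime.sym (prime∤⇒coprime p-prime p∤g)) (subst (g ∣_) (*-comm (m * p) p) g∣mpp)
... | yes (divides h refl) = *-monoˡ-∣ p h∣m
  where
  instance _ = prime⇒nonZero p-prime
  h∣m : h ∣ m
  h∣m = coprime-divisor (Coprime.sym (prime∤⇒coprime p-prime λ p∣h → p²∤g (*-monoˡ-∣ p p∣h)))
          (subst (h ∣_) (*-comm m p) (*-cancelʳ-∣ p g∣mpp))

coprime-^ˡ : ∀ {m n} k → Coprime m n → Coprime (m ^ k) n
coprime-^ˡ zero    m⊥n (d∣1 , _)       = ∣1⇒≡1 d∣1
coprime-^ˡ (suc k) m⊥n (d∣m*mᵏ , d∣n) = coprime-^ˡ k m⊥n (coprime-divisor d⊥m d∣m*mᵏ , d∣n)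
  where
  d⊥m : Coprime _ _
  d⊥m (e∣d , e∣m) = m⊥n (e∣m , ∣-trans e∣d d∣n)

coprime-∣-* : ∀ {m n Q} → Coprime m n → m ∣ Q → n ∣ Q → m * n ∣ Q
coprime-∣-* {m} {n} m⊥n (divides c refl) n∣cm =
  subst (m * n ∣_) (*-comm m c) (*-monoʳ-∣ m (coprime-divisor (Coprime.sym m⊥n) (subst (n ∣_) (*-comm c m) n∣cm)))

≡1-mod⇒ : ∀ {M a} .{{_ : NonZero M}} → 1 ≤ a → a ≡ 1 mod M → ∃[ t ] a ≡ 1 + M * t
≡1-mod⇒ {M} {a} 1≤a a≡1 with ≡-mod⇒∣∸ a≡1
... | divides t a∸1≡t*M = t , trans (sym (m+[n∸m]≡n 1≤a)) (cong suc (trans a∸1≡t*M (*-comm t M)))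

module _ {M} .{{_ : NonZero M}} (a : ℕ) where

  ^≡1-*-closed : ∀ c {e} → a ^ e ≡ 1 mod M → a ^ (c * e) ≡ 1 mod M
  ^≡1-*-closed c {e} aᵉ≡1 = begin
    a ^ (c * e)   ≡⟨ trans (^-*-assoc a e c) (cong (a ^_) (*-comm e c)) ⟨
    (a ^ e) ^ c   ≈⟨ ^-cong-mod c aᵉ≡1 ⟩
    1 ^ c         ≡⟨ ^-zeroˡ c ⟩
    1             ∎
    where open SetoidReasoning ≡-mod-setoid

  ^≡1-∸-closed : ∀ {e f} → a ^ e ≡ 1 mod M → a ^ f ≡ 1 mod M → f ≤ e → a ^ (e ∸ f) ≡ 1 mod M
  ^≡1-∸-closed {e} {f} aᵉ≡1 aᶠ≡1 f≤e = begin
    a ^ (e ∸ f)           ≡⟨ *-identityʳ (a ^ (e ∸ f)) ⟨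
    a ^ (e ∸ f) * 1       ≈⟨ *-cong-mod (≡-mod-refl {x = a ^ (e ∸ f)}) aᶠ≡1 ⟨
    a ^ (e ∸ f) * a ^ f   ≡⟨ trans (cong (a ^_) (sym (m∸n+n≡m f≤e))) (^-distribˡ-+-* a (e ∸ f) f) ⟨
    a ^ e                 ≈⟨ aᵉ≡1 ⟩
    1                     ∎
    where open SetoidReasoning ≡-mod-setoid

  open SubtractiveClosure (λ e → a ^ e ≡ 1 mod M) ^≡1-*-closed ^≡1-∸-closed public
    renaming (gcd-closed to ^≡1-gcd-closed)

^≡1-mod-exists : ∀ {a M} .{{_ : NonZero M}} → Coprime M a → ∃[ d ] 0 < d × a ^ d ≡ 1 mod M
^≡1-mod-exists {a} {M} M⊥a with Fin.pigeonhole (n<1+n M) (λ (j : Fin (suc M)) → red M (a ^ toℕ j))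
... | i , j , i<j , aⁱ≡aʲ = toℕ j ∸ toℕ i , m<n⇒0<n∸m i<j , ^-*-cancelˡ-mod (toℕ i) M⊥a (begin
  a ^ toℕ i * a ^ (toℕ j ∸ toℕ i)   ≡⟨ ^-distribˡ-+-* a (toℕ i) _ ⟨
  a ^ (toℕ i + (toℕ j ∸ toℕ i))     ≡⟨ cong (a ^_) (m+[n∸m]≡n (<⇒≤ i<j)) ⟩
  a ^ toℕ j                          ≈⟨ toℕ-red M (a ^ toℕ j) ⟨
  toℕ (red M (a ^ toℕ j))            ≡⟨ cong toℕ aⁱ≡aʲ ⟨
  toℕ (red M (a ^ toℕ i))            ≈⟨ toℕ-red M (a ^ toℕ i) ⟩
  a ^ toℕ i                          ≡⟨ *-identityʳ (a ^ toℕ i) ⟨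
  a ^ toℕ i * 1                      ∎)
  where open SetoidReasoning ≡-mod-setoid

fermat-2 : ∀ {p} .{{_ : NonZero p}} → Prime p → 2 < p → 2 ^ (p ∸ 1) ≡ 1 mod p
fermat-2 {suc q} p-prime 2<p = *-cancelˡ-mod (Coprime.prime⇒coprime p-prime 2<p) (begin
  2 ^ suc q                        ≡⟨ binomialSum-1 (suc q) ⟨
  binomialSum (suc q) (λ _ → 1)    ≈⟨ binomialSum-prime p-prime (λ _ → 1) ⟩
  2 * 1                            ∎)
  where open SetoidReasoning ≡-mod-setoid

1+y^k-expansion : ∀ y k → ∃[ W ] (1 + y) ^ k ≡ 1 + k * y + (k C 2) * (y * y) + y * y * y * W
1+y^k-expansion y zero    = 0 , base y
  where
  base : ∀ y → 1 ≡ 1 + 0 * y + 0 * (y * y) + y * y * y * 0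
  base = solve-∀
1+y^k-expansion y (suc k) with 1+y^k-expansion y k
... | W , eq = W + (k C 2) + y * W , (begin
  (1 + y) * (1 + y) ^ k
    ≡⟨ cong ((1 + y) *_) eq ⟩
  (1 + y) * (1 + k * y + (k C 2) * (y * y) + y * y * y * W)
    ≡⟨ step y k (k C 2) W ⟩
  1 + suc k * y + (k + (k C 2)) * (y * y) + y * y * y * (W + (k C 2) + y * W)
    ≡⟨ cong (λ c → 1 + suc k * y + c * (y * y) + y * y * y * (W + (k C 2) + y * W)) pascal ⟩
  1 + suc k * y + (suc k C 2) * (y * y) + y * y * y * (W + (k C 2) + y * W)
    ∎)
  where
  open ≡-Reasoning
  step : ∀ y k c W → (1 + y) * (1 + k * y + c * (y * y) + y * y * y * W)
                   ≡ 1 + suc k * y + (k + c) * (y * y) + y * y * y * (W + c + y * W)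
  step = solve-∀
  pascal : k + (k C 2) ≡ suc k C 2
  pascal = trans (cong (_+ (k C 2)) (sym (nC1≡n k))) (nCk+nC[k+1]≡[n+1]C[k+1] k 1)

module OddPrime {p : ℕ} .{{_ : NonZero p}} (p-prime : Prime p) (2<p : 2 < p) where

  instance
    p²≢0 : NonZero (p ^ 2)
    p²≢0 = m^n≢0 p 2
    p³≢0 : NonZero (p ^ 3)
    p³≢0 = m^n≢0 p 3

  coprime-p^k-2 : ∀ k → Coprime (p ^ k) 2
  coprime-p^k-2 k = Coprime.sym (prime∤⇒coprime prime[2] λ 2∣p^k → 2∤p (prime∣^⇒∣ k prime[2] 2∣p^k))
    where
    2∤p : ¬ 2 ∣ p
    2∤p 2∣p with prime⇒irreducible p-prime 2∣p
    ... | inj₂ 2≡p = <⇒≢ 2<p 2≡p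

  -- p ∣ p C 2, so beyond the linear term every summand of the expansion is a multiple of p³.
  [1+p*x]^p≡1+p²*x : ∀ x → (1 + p * x) ^ p ≡ 1 + p ^ 2 * x mod p ^ 3
  [1+p*x]^p≡1+p²*x x with 1+y^k-expansion (p * x) p | prime∣pCj p-prime z<s 2<p
  ... | W , eq | divides u pC2≡u*p = begin
    (1 + p * x) ^ p
      ≡⟨ eq ⟩
    1 + p * (p * x) + (p C 2) * (p * x * (p * x)) + p * x * (p * x) * (p * x) * W
      ≡⟨ cong (λ c → 1 + p * (p * x) + c * (p * x * (p * x)) + p * x * (p * x) * (p * x) * W) pC2≡u*p ⟩
    1 + p * (p * x) + u * p * (p * x * (p * x)) + p * x * (p * x) * (p * x) * W
      ≡⟨ regroup p x u W ⟩
    1 + p ^ 2 * x + p ^ 3 * (u * x * x + x * x * x * W)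
      ≈⟨ +-*-≡-mod (1 + p ^ 2 * x) _ ⟩
    1 + p ^ 2 * x
      ∎
    where
    open SetoidReasoning (≡-mod-setoid {p ^ 3})
    regroup : ∀ p x u W → 1 + p * (p * x) + u * p * (p * x * (p * x)) + p * x * (p * x) * (p * x) * W
                        ≡ 1 + p * (p * 1) * x + p * (p * (p * 1)) * (u * x * x + x * x * x * W)
    regroup = solve-∀

≡1-mod-p²⇒wieferich : ∀ {p} .{{_ : NonZero p}} .{{_ : NonZero (p ^ 2)}} → 2 ^ (p ∸ 1) ≡ 1 mod p ^ 2 → IsWieferich p
≡1-mod-p²⇒wieferich {suc q} (mod-≡ e) = trans (sym (%-congʳ {o = 2 ^ q} p²≡p*p)) (trans e (%-congʳ {o = 1} p²≡p*p))
  where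
  p²≡p*p : suc q ^ 2 ≡ suc q * suc q
  p²≡p*p = cong (suc q *_) (*-identityʳ (suc q))

module NonWieferich {p : ℕ} .{{_ : NonZero p}} (p-prime : Prime p) (2<p : 2 < p) (non-wieferich : ¬ IsWieferich p) where

  open OddPrime p-prime 2<p public

  private
    fermat-quotient : ∃[ t ] 2 ^ (p ∸ 1) ≡ 1 + p * t
    fermat-quotient = ≡1-mod⇒ (m^n>0 2 (p ∸ 1)) (fermat-2 p-prime 2<p)

    t : ℕ
    t = proj₁ fermat-quotient

    p∤t : ¬ p ∣ t
    p∤t (divides c t≡c*p) = non-wieferich (≡1-mod-p²⇒wieferich (begin
      2 ^ (p ∸ 1)        ≡⟨ proj₂ fermat-quotient ⟩
      1 + p * t          ≡⟨ cong (λ x → 1 + p * x) t≡c*p ⟩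
      1 + p * (c * p)    ≡⟨ cong suc (regroup p c) ⟩
      1 + p ^ 2 * c      ≈⟨ +-*-≡-mod 1 c ⟩
      1                  ∎))
      where
      open SetoidReasoning (≡-mod-setoid {p ^ 2})
      regroup : ∀ p c → p * (c * p) ≡ p * (p * 1) * c
      regroup = solve-∀

  2^[[p-1]*p]≡1+p²*t : 2 ^ ((p ∸ 1) * p) ≡ 1 + p ^ 2 * t mod p ^ 3
  2^[[p-1]*p]≡1+p²*t = begin
    2 ^ ((p ∸ 1) * p)     ≡⟨ ^-*-assoc 2 (p ∸ 1) p ⟨
    (2 ^ (p ∸ 1)) ^ p     ≡⟨ cong (_^ p) (proj₂ fermat-quotient) ⟩
    (1 + p * t) ^ p       ≈⟨ [1+p*x]^p≡1+p²*x t ⟩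
    1 + p ^ 2 * t         ∎
    where open SetoidReasoning (≡-mod-setoid {p ^ 3})

  2^[[p-1]*p]≡1-mod-p² : 2 ^ ((p ∸ 1) * p) ≡ 1 mod p ^ 2
  2^[[p-1]*p]≡1-mod-p² = ≡-mod-trans (≡-mod-∣-weaken (n∣m*n p) 2^[[p-1]*p]≡1+p²*t) (+-*-≡-mod 1 t)

  2^[[p-1]*p*p]≡1-mod-p³ : 2 ^ ((p ∸ 1) * p * p) ≡ 1 mod p ^ 3
  2^[[p-1]*p*p]≡1-mod-p³ = begin
    2 ^ ((p ∸ 1) * p * p)     ≡⟨ ^-*-assoc 2 ((p ∸ 1) * p) p ⟨
    (2 ^ ((p ∸ 1) * p)) ^ p   ≡⟨ cong (_^ p) (trans (proj₂ 2^[[p-1]*p]≡1+p²*s) (cong suc (regroup p s))) ⟩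
    (1 + p * (p * s)) ^ p     ≈⟨ [1+p*x]^p≡1+p²*x (p * s) ⟩
    1 + p ^ 2 * (p * s)       ≡⟨ cong suc (regroup′ p s) ⟩
    1 + p ^ 3 * s             ≈⟨ +-*-≡-mod 1 s ⟩
    1                         ∎
    where
    open SetoidReasoning (≡-mod-setoid {p ^ 3})
    2^[[p-1]*p]≡1+p²*s : ∃[ s ] 2 ^ ((p ∸ 1) * p) ≡ 1 + p ^ 2 * s
    2^[[p-1]*p]≡1+p²*s = ≡1-mod⇒ (m^n>0 2 ((p ∸ 1) * p)) 2^[[p-1]*p]≡1-mod-p²
    s : ℕ
    s = proj₁ 2^[[p-1]*p]≡1+p²*s
    regroup : ∀ p s → p * (p * 1) * s ≡ p * (p * s)
    regroup = solve-∀
    regroup′ : ∀ p s → p * (p * 1) * (p * s) ≡ p * (p * (p * 1)) * s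
    regroup′ = solve-∀

  2^e≡1-mod-p²⇒p∣e : ∀ {e} → 2 ^ e ≡ 1 mod p ^ 2 → p ∣ e
  2^e≡1-mod-p²⇒p∣e {e} 2ᵉ≡1 with p ∣? e
  ... | yes p∣e = p∣e
  ... | no  p∤e = ⊥-elim (non-wieferich (≡1-mod-p²⇒wieferich
          (subst (λ f → 2 ^ f ≡ 1 mod p ^ 2) (sym (m∣n⇒n≡quotient*m g∣p-1))
            (^≡1-*-closed 2 (quotient g∣p-1) 2ᵍ≡1))))
    where
    g = gcd e ((p ∸ 1) * p)
    2ᵍ≡1 : 2 ^ g ≡ 1 mod p ^ 2
    2ᵍ≡1 = ^≡1-gcd-closed 2 {e} {(p ∸ 1) * p} 2ᵉ≡1 2^[[p-1]*p]≡1-mod-p²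
    g∣p-1 : g ∣ p ∸ 1
    g∣p-1 = coprime-divisor (Coprime.sym (prime∤⇒coprime p-prime λ p∣g → p∤e (∣-trans p∣g (gcd[m,n]∣m e _))))
              (subst (g ∣_) (*-comm (p ∸ 1) p) (gcd[m,n]∣n e _))

  2^e≡1-mod-p³⇒p²∣e : ∀ {e} → 2 ^ e ≡ 1 mod p ^ 3 → p ^ 2 ∣ e
  2^e≡1-mod-p³⇒p²∣e {e} 2ᵉ≡1 with p ^ 2 ∣? e
  ... | yes p²∣e = p²∣e
  ... | no  p²∤e = ⊥-elim (p∤t (*-cancelˡ-∣ (p ^ 2) p³∣p²t))
    where
    p²≡p*p : p ^ 2 ≡ p * p
    p²≡p*p = cong (p *_) (*-identityʳ p)
    g = gcd e ((p ∸ 1) * p * p)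
    2ᵍ≡1 : 2 ^ g ≡ 1 mod p ^ 3
    2ᵍ≡1 = ^≡1-gcd-closed 2 {e} {(p ∸ 1) * p * p} 2ᵉ≡1 2^[[p-1]*p*p]≡1-mod-p³
    g∣[p-1]*p : g ∣ (p ∸ 1) * p
    g∣[p-1]*p = ∣m*p*p⇒∣m*p (p ∸ 1) p-prime (gcd[m,n]∣n e _)
                  λ p*p∣g → p²∤e (∣-trans (subst (_∣ g) (sym p²≡p*p) p*p∣g) (gcd[m,n]∣m e _))
    1+p²t≡1 : 1 + p ^ 2 * t ≡ 1 mod p ^ 3
    1+p²t≡1 = ≡-mod-trans (≡-mod-sym 2^[[p-1]*p]≡1+p²*t)
      (subst (λ f → 2 ^ f ≡ 1 mod p ^ 3) (sym (m∣n⇒n≡quotient*m g∣[p-1]*p)) (^≡1-*-closed 2 (quotient g∣[p-1]*p) 2ᵍ≡1))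
    p³∣p²t : p ^ 2 * p ∣ p ^ 2 * t
    p³∣p²t = subst₂ _∣_ (*-comm p (p ^ 2)) (m+n∸m≡n 1 (p ^ 2 * t)) (≡-mod⇒∣∸ 1+p²t≡1)

∑-select : ∀ {m} (f : Fin (suc m) → ℕ) i → (∀ j → j ≢ i → f j ≡ 0) → sum f ≡ f i
∑-select {m} f i others = begin
  sum f                   ≡⟨ sum-remove f ⟩
  f i + sum (removeAt f i) ≡⟨ cong (f i +_) (trans (sum-cong-≗ (λ j → others _ (Fin.punchInᵢ≢i i j))) (sum-replicate-zero m)) ⟩
  f i + 0                 ≡⟨ +-identityʳ (f i) ⟩
  f i                     ∎
  where open ≡-Reasoning

module Iteration {A : Set} where

  open Endo A public using () renaming (_^_ to _^ᶠ_)
  open MonoidMult (Endo.∘-id-monoid A) using (×-assocˡ)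

  ^ᶠ-+ : ∀ (f : A → A) m n a → (f ^ᶠ (m + n)) a ≡ (f ^ᶠ m) ((f ^ᶠ n) a)
  ^ᶠ-+ f m n a = cong-app (Endo.^-homo A f m n) a

  ^ᶠ-* : ∀ (f : A → A) m n a → (f ^ᶠ (m * n)) a ≡ ((f ^ᶠ n) ^ᶠ m) a
  ^ᶠ-* f m n a = cong-app (sym (×-assocˡ f m n)) a

  ^ᶠ-comm : ∀ (f : A → A) m n a → (f ^ᶠ m) ((f ^ᶠ n) a) ≡ (f ^ᶠ n) ((f ^ᶠ m) a)
  ^ᶠ-comm f m n a = trans (sym (^ᶠ-+ f m n a)) (trans (cong (λ k → (f ^ᶠ k) a) (+-comm m n)) (^ᶠ-+ f n m a))

module Circulant (n′ : ℕ) where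

  n : ℕ
  n = suc n′

  Vecℕ : Set
  Vecℕ = Fin n → ℕ

  open Iteration {Vecℕ} public

  infixl 6 _⊕_ _⊖_

  -- Written s + toℕ i (not toℕ i + s) so that nextIx n i is definitionally i ⊕ 1.
  _⊕_ : Fin n → ℕ → Fin n
  i ⊕ s = red n (s + toℕ i)

  _⊖_ : Fin n → Fin n → Fin n
  i ⊖ r = i ⊕ (n ∸ toℕ r)

  toℕ-⊕ : ∀ i s → toℕ (i ⊕ s) ≡ s + toℕ i mod n
  toℕ-⊕ i s = toℕ-red n (s + toℕ i)

  ⊕-cong-mod : ∀ i {s t} → s ≡ t mod n → i ⊕ s ≡ i ⊕ t
  ⊕-cong-mod i {s} {t} s≡t = toℕ-≡-mod⇒≡ (begin
    toℕ (i ⊕ s)   ≈⟨ toℕ-⊕ i s ⟩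
    s + toℕ i     ≈⟨ +-cong-mod s≡t ≡-mod-refl ⟩
    t + toℕ i     ≈⟨ toℕ-⊕ i t ⟨
    toℕ (i ⊕ t)   ∎)
    where open SetoidReasoning ≡-mod-setoid

  ⊕-assoc : ∀ i s t → i ⊕ s ⊕ t ≡ i ⊕ (s + t)
  ⊕-assoc i s t = toℕ-≡-mod⇒≡ (begin
    toℕ (i ⊕ s ⊕ t)       ≈⟨ toℕ-⊕ (i ⊕ s) t ⟩
    t + toℕ (i ⊕ s)       ≈⟨ +-cong-mod (≡-mod-refl {x = t}) (toℕ-⊕ i s) ⟩
    t + (s + toℕ i)       ≡⟨ trans (cong (_+ toℕ i) (+-comm s t)) (+-assoc t s (toℕ i)) ⟨
    s + t + toℕ i         ≈⟨ toℕ-⊕ i (s + t) ⟨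
    toℕ (i ⊕ (s + t))     ∎)
    where open SetoidReasoning ≡-mod-setoid

  ⊕-comm : ∀ i s t → i ⊕ s ⊕ t ≡ i ⊕ t ⊕ s
  ⊕-comm i s t = trans (⊕-assoc i s t) (trans (cong (i ⊕_) (+-comm s t)) (sym (⊕-assoc i t s)))

  ⊕-identityʳ : ∀ i → i ⊕ 0 ≡ i
  ⊕-identityʳ i = toℕ-≡-mod⇒≡ (toℕ-⊕ i 0)

  n≡0-mod-n : n ≡ 0 mod n
  n≡0-mod-n = ∣⇒≡0-mod ∣-refl

  ⊖-self : ∀ i → i ⊖ i ≡ Fin.zero
  ⊖-self i = toℕ-≡-mod⇒≡ (≡-mod-trans (toℕ-⊕ i (n ∸ toℕ i))
    (≡-mod-trans (≡⇒≡-mod (m∸n+n≡m (<⇒≤ (Fin.toℕ<n i)))) n≡0-mod-n))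

  ⊖≡zero⇒≡ : ∀ i r → i ⊖ r ≡ Fin.zero → i ≡ r
  ⊖≡zero⇒≡ i r i⊖r≡0 = begin
    i                         ≡⟨ ⊕-identityʳ i ⟨
    i ⊕ 0                     ≡⟨ ⊕-cong-mod i (≡-mod-sym (≡-mod-trans (≡⇒≡-mod (m∸n+n≡m (<⇒≤ (Fin.toℕ<n r)))) n≡0-mod-n)) ⟩
    i ⊕ (n ∸ toℕ r + toℕ r)  ≡⟨ ⊕-assoc i (n ∸ toℕ r) (toℕ r) ⟨
    i ⊖ r ⊕ toℕ r            ≡⟨ cong (_⊕ toℕ r) i⊖r≡0 ⟩
    Fin.zero ⊕ toℕ r         ≡⟨ toℕ-≡-mod⇒≡ (≡-mod-trans (toℕ-⊕ Fin.zero (toℕ r)) (≡⇒≡-mod (+-identityʳ (toℕ r)))) ⟩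
    r                         ∎
    where open ≡-Reasoning

  ∑-⊕1 : ∀ (β : Vecℕ) → ∑[ i < n ] β (i ⊕ 1) ≡ sum β
  ∑-⊕1 β = begin
    ∑[ i < n ] β (i ⊕ 1)                                        ≡⟨ sum-init-last (λ i → β (i ⊕ 1)) ⟩
    ∑[ j < n′ ] β (inject₁ j ⊕ 1) + β (fromℕ n′ ⊕ 1)            ≡⟨ cong₂ _+_ (sum-cong-≗ (cong β ∘ inject₁⊕1)) (cong β last⊕1) ⟩
    ∑[ j < n′ ] β (Fin.suc j) + β Fin.zero                       ≡⟨ +-comm _ (β Fin.zero) ⟩
    sum β                                                        ∎
    where
    open ≡-Reasoning
    inject₁⊕1 : ∀ j → inject₁ j ⊕ 1 ≡ Fin.suc j
    inject₁⊕1 j = toℕ-≡-mod⇒≡ (≡-mod-trans (toℕ-⊕ (inject₁ j) 1) (≡⇒≡-mod (cong suc (Fin.toℕ-inject₁ j))))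
    last⊕1 : fromℕ n′ ⊕ 1 ≡ Fin.zero
    last⊕1 = toℕ-≡-mod⇒≡ (≡-mod-trans (toℕ-⊕ (fromℕ n′) 1) (≡-mod-trans (≡⇒≡-mod (cong suc (Fin.toℕ-fromℕ n′))) n≡0-mod-n))

  U : ℕ → Vecℕ → Vecℕ
  U s α i = α i + α (i ⊕ s)

  -- The Ducci map without reduction: it is ℕ-linear, and T m n is Tℕ read modulo m (toℕ-Tˢ below).
  Tℕ : Vecℕ → Vecℕ
  Tℕ = U 1

  δ : Vecℕ
  δ Fin.zero    = 1
  δ (Fin.suc _) = 0

  infix 4 _≋_mod_
  _≋_mod_ : Vecℕ → Vecℕ → (M : ℕ) → .{{NonZero M}} → Set
  α ≋ β mod M = ∀ i → α i ≡ β i mod M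

  module _ {M : ℕ} .{{_ : NonZero M}} where

    ≋-mod-setoid : Setoid _ _
    ≋-mod-setoid = record
      { Carrier = Vecℕ
      ; _≈_ = λ α β → α ≋ β mod M
      ; isEquivalence = record
        { refl = λ i → ≡-mod-refl
        ; sym = λ α≋β i → ≡-mod-sym (α≋β i)
        ; trans = λ α≋β β≋γ i → ≡-mod-trans (α≋β i) (β≋γ i)
        }
      }

    U-cong-mod : ∀ s {α β} → α ≋ β mod M → U s α ≋ U s β mod M
    U-cong-mod s α≋β i = +-cong-mod (α≋β i) (α≋β (i ⊕ s))

    ^ᶠ-cong-mod : ∀ {F} → (∀ {α β} → α ≋ β mod M → F α ≋ F β mod M) →
                  ∀ k {α β} → α ≋ β mod M → (F ^ᶠ k) α ≋ (F ^ᶠ k) β mod M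
    ^ᶠ-cong-mod F-cong zero    α≋β = α≋β
    ^ᶠ-cong-mod F-cong (suc k) α≋β = F-cong (^ᶠ-cong-mod F-cong k α≋β)

    ^ᶠ-cong₂-mod : ∀ {F G} → (∀ {α β} → α ≋ β mod M → F α ≋ F β mod M) →
                   (∀ α → F α ≋ G α mod M) → ∀ k α → (F ^ᶠ k) α ≋ (G ^ᶠ k) α mod M
    ^ᶠ-cong₂-mod F-cong F≋G zero    α i = ≡-mod-refl
    ^ᶠ-cong₂-mod F-cong F≋G (suc k) α i =
      ≡-mod-trans (F-cong (^ᶠ-cong₂-mod F-cong F≋G k α) i) (F≋G _ i)

  U^-+ : ∀ s k α β → (U s ^ᶠ k) (λ i → α i + β i) ≗ (λ i → (U s ^ᶠ k) α i + (U s ^ᶠ k) β i)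
  U^-+ s zero    α β i = refl
  U^-+ s (suc k) α β i = trans (cong₂ _+_ (U^-+ s k α β i) (U^-+ s k α β (i ⊕ s)))
    (regroup ((U s ^ᶠ k) α i) ((U s ^ᶠ k) β i) ((U s ^ᶠ k) α (i ⊕ s)) ((U s ^ᶠ k) β (i ⊕ s)))
    where
    regroup : ∀ a b c d → a + b + (c + d) ≡ a + c + (b + d)
    regroup = solve-∀

  U^-* : ∀ s k c α → (U s ^ᶠ k) (λ i → c * α i) ≗ (λ i → c * (U s ^ᶠ k) α i)
  U^-* s zero    c α i = refl
  U^-* s (suc k) c α i = trans (cong₂ _+_ (U^-* s k c α i) (U^-* s k c α (i ⊕ s))) (sym (*-distribˡ-+ c _ _))

  U^-cong : ∀ s k {α β} → α ≗ β → (U s ^ᶠ k) α ≗ (U s ^ᶠ k) β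
  U^-cong s zero    α≗β = α≗β
  U^-cong s (suc k) α≗β i = cong₂ _+_ (U^-cong s k α≗β i) (U^-cong s k α≗β (i ⊕ s))

  U^-linear : ∀ s k α c β → (U s ^ᶠ k) (λ i → α i + c * β i) ≗ (λ i → (U s ^ᶠ k) α i + c * (U s ^ᶠ k) β i)
  U^-linear s k α c β i = trans (U^-+ s k α (λ i → c * β i) i) (cong ((U s ^ᶠ k) α i +_) (U^-* s k c β i))

  U^-binomial : ∀ s k α i → (U s ^ᶠ k) α i ≡ binomialSum k (λ j → α (i ⊕ j * s))
  U^-binomial s zero    α i = sym (trans (+-identityʳ _) (trans (*-identityˡ _) (cong α (⊕-identityʳ i))))
  U^-binomial s (suc k) α i = begin
    (U s ^ᶠ k) α i + (U s ^ᶠ k) α (i ⊕ s)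
      ≡⟨ cong₂ _+_ (U^-binomial s k α i) (U^-binomial s k α (i ⊕ s)) ⟩
    binomialSum k x + binomialSum k (λ j → α (i ⊕ s ⊕ j * s))
      ≡⟨ cong (binomialSum k x +_) (sum-cong-≗ {suc k} λ j → cong (λ l → (k C toℕ j) * α l) (⊕-assoc i s (toℕ j * s))) ⟩
    binomialSum k x + binomialSum k (x ∘ suc)
      ≡⟨ binomialSum-suc k x ⟨
    binomialSum (suc k) x
      ∎
    where
    open ≡-Reasoning
    x : ℕ → ℕ
    x j = α (i ⊕ j * s)

  module Frobenius {p : ℕ} .{{_ : NonZero p}} (p-prime : Prime p) where

    U^p≋U[p*s] : ∀ s α → (U s ^ᶠ p) α ≋ U (p * s) α mod p
    U^p≋U[p*s] s α i = begin
      (U s ^ᶠ p) α i                        ≡⟨ U^-binomial s p α i ⟩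
      binomialSum p (λ j → α (i ⊕ j * s))   ≈⟨ binomialSum-prime p-prime (λ j → α (i ⊕ j * s)) ⟩
      α (i ⊕ 0) + α (i ⊕ p * s)             ≡⟨ cong (λ l → α l + α (i ⊕ p * s)) (⊕-identityʳ i) ⟩
      U (p * s) α i                         ∎
      where open SetoidReasoning ≡-mod-setoid

    Tℕ^[p^j]≋U[p^j] : ∀ j α → (Tℕ ^ᶠ (p ^ j)) α ≋ U (p ^ j) α mod p
    Tℕ^[p^j]≋U[p^j] zero    α i = ≡-mod-refl
    Tℕ^[p^j]≋U[p^j] (suc j) α i = begin
      (Tℕ ^ᶠ (p * p ^ j)) α i            ≡⟨ cong-app (^ᶠ-* Tℕ p (p ^ j) α) i ⟩
      ((Tℕ ^ᶠ (p ^ j)) ^ᶠ p) α i         ≈⟨ ^ᶠ-cong₂-mod (^ᶠ-cong-mod (U-cong-mod 1) (p ^ j)) (Tℕ^[p^j]≋U[p^j] j) p α i ⟩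
      (U (p ^ j) ^ᶠ p) α i              ≈⟨ U^p≋U[p*s] (p ^ j) α i ⟩
      U (p * p ^ j) α i                 ∎
      where open SetoidReasoning ≡-mod-setoid

    Tℕ^[p^d]≋Tℕ : ∀ {d} → p ^ d ≡ 1 mod n → ∀ α → (Tℕ ^ᶠ (p ^ d)) α ≋ Tℕ α mod p
    Tℕ^[p^d]≋Tℕ {d} p^d≡1 α i =
      ≡-mod-trans (Tℕ^[p^j]≋U[p^j] d α i) (≡⇒≡-mod (cong (λ l → α i + α l) (⊕-cong-mod i p^d≡1)))

  -- Every vector is a combination of cyclic shifts of δ, and Tℕ commutes with shifts.
  Tℕ^-convolution : ∀ k α i → (Tℕ ^ᶠ k) α i ≡ ∑[ r < n ] (α r * (Tℕ ^ᶠ k) δ (i ⊖ r))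
  Tℕ^-convolution zero    α i = sym (trans (∑-select _ i others) (trans (cong (λ j → α i * δ j) (⊖-self i)) (*-identityʳ (α i))))
    where
    others : ∀ r → r ≢ i → α r * δ (i ⊖ r) ≡ 0
    others r r≢i with i ⊖ r in eq
    ... | Fin.zero  = ⊥-elim (r≢i (sym (⊖≡zero⇒≡ i r eq)))
    ... | Fin.suc _ = *-zeroʳ (α r)
  Tℕ^-convolution (suc k) α i = begin
    (Tℕ ^ᶠ k) α i + (Tℕ ^ᶠ k) α (i ⊕ 1)
      ≡⟨ cong₂ _+_ (Tℕ^-convolution k α i) (Tℕ^-convolution k α (i ⊕ 1)) ⟩
    ∑[ r < n ] (α r * D (i ⊖ r)) + ∑[ r < n ] (α r * D (i ⊕ 1 ⊖ r))
      ≡⟨ cong (∑[ r < n ] (α r * D (i ⊖ r)) +_) (sum-cong-≗ λ r → cong (λ j → α r * D j) (⊕-comm i 1 (n ∸ toℕ r))) ⟩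
    ∑[ r < n ] (α r * D (i ⊖ r)) + ∑[ r < n ] (α r * D (i ⊖ r ⊕ 1))
      ≡⟨ ∑-distrib-+ (λ r → α r * D (i ⊖ r)) (λ r → α r * D (i ⊖ r ⊕ 1)) ⟨
    ∑[ r < n ] (α r * D (i ⊖ r) + α r * D (i ⊖ r ⊕ 1))
      ≡⟨ sum-cong-≗ (λ r → *-distribˡ-+ (α r) (D (i ⊖ r)) (D (i ⊖ r ⊕ 1))) ⟨
    ∑[ r < n ] (α r * (Tℕ ^ᶠ suc k) δ (i ⊖ r))
      ∎
    where
    open ≡-Reasoning
    D : Vecℕ
    D = (Tℕ ^ᶠ k) δ

  Tℕ^-≋-from-δ : ∀ {M} .{{_ : NonZero M}} {j k} → (Tℕ ^ᶠ j) δ ≋ (Tℕ ^ᶠ k) δ mod M → ∀ α → (Tℕ ^ᶠ j) α ≋ (Tℕ ^ᶠ k) α mod M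
  Tℕ^-≋-from-δ {j = j} {k} Tℕʲδ≋Tℕᵏδ α i = begin
    (Tℕ ^ᶠ j) α i                              ≡⟨ Tℕ^-convolution j α i ⟩
    ∑[ r < n ] (α r * (Tℕ ^ᶠ j) δ (i ⊖ r))    ≈⟨ ∑-cong-mod (λ r → *-cong-mod (≡-mod-refl {x = α r}) (Tℕʲδ≋Tℕᵏδ (i ⊖ r))) ⟩
    ∑[ r < n ] (α r * (Tℕ ^ᶠ k) δ (i ⊖ r))    ≡⟨ Tℕ^-convolution k α i ⟨
    (Tℕ ^ᶠ k) α i                              ∎
    where open SetoidReasoning ≡-mod-setoid

  ∑-Tℕ : ∀ β → sum (Tℕ β) ≡ 2 * sum β
  ∑-Tℕ β = begin
    ∑[ i < n ] (β i + β (i ⊕ 1))      ≡⟨ ∑-distrib-+ β (λ i → β (i ⊕ 1)) ⟩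
    sum β + ∑[ i < n ] β (i ⊕ 1)      ≡⟨ cong (sum β +_) (trans (∑-⊕1 β) (sym (+-identityʳ (sum β)))) ⟩
    2 * sum β                          ∎
    where open ≡-Reasoning

  ∑-Tℕ^δ : ∀ k → sum ((Tℕ ^ᶠ k) δ) ≡ 2 ^ k
  ∑-Tℕ^δ zero    = cong suc (sum-replicate-zero n′)
  ∑-Tℕ^δ (suc k) = trans (∑-Tℕ ((Tℕ ^ᶠ k) δ)) (cong (2 *_) (∑-Tℕ^δ k))

module OrbitPeriods (n′ : ℕ) where

  open Circulant n′

  module Orbit (M : ℕ) .{{_ : NonZero M}} (α : Vecℕ) =
    EventualPeriods (≋-mod-setoid {M}) (λ k → (Tℕ ^ᶠ k) α) (U-cong-mod 1)

  AllPeriodicFrom : (M : ℕ) → .{{NonZero M}} → ℕ → ℕ → Set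
  AllPeriodicFrom M K Q = ∀ α → Orbit.PeriodicFrom M α K Q

  δ-periodicFrom⇒all : ∀ {M} .{{_ : NonZero M}} {K Q} → Orbit.PeriodicFrom M δ K Q → AllPeriodicFrom M K Q
  δ-periodicFrom⇒all {K = K} {Q} δ-periodic α k K≤k = Tℕ^-≋-from-δ {j = k + Q} {k} (δ-periodic k K≤k) α

  periodicFrom-∣-weaken : ∀ {M D} .{{_ : NonZero M}} .{{_ : NonZero D}} → D ∣ M →
                          ∀ {α K Q} → Orbit.PeriodicFrom M α K Q → Orbit.PeriodicFrom D α K Q
  periodicFrom-∣-weaken D∣M periodic k K≤k i = ≡-mod-∣-weaken D∣M (periodic k K≤k i)

  Tℕ-periodicFrom-1 : ∀ {p d} .{{_ : NonZero p}} → Prime p → p ^ d ≡ 1 mod n → AllPeriodicFrom p 1 (p ^ d ∸ 1)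
  Tℕ-periodicFrom-1 {p} {d} p-prime p^d≡1 α (suc k) _ = begin
    (Tℕ ^ᶠ (suc k + (p ^ d ∸ 1))) α   ≡⟨ cong (λ e → (Tℕ ^ᶠ e) α) (trans (sym (+-suc k (p ^ d ∸ 1))) (cong (k +_) (m+[n∸m]≡n (m^n>0 p d)))) ⟩
    (Tℕ ^ᶠ (k + p ^ d)) α             ≡⟨ ^ᶠ-+ Tℕ k (p ^ d) α ⟩
    (Tℕ ^ᶠ k) ((Tℕ ^ᶠ (p ^ d)) α)     ≈⟨ ^ᶠ-cong-mod {F = Tℕ} (U-cong-mod 1) k (Frobenius.Tℕ^[p^d]≋Tℕ p-prime {d} p^d≡1 α) ⟩
    (Tℕ ^ᶠ k) (Tℕ α)                  ≡⟨ trans (sym (^ᶠ-+ Tℕ k 1 α)) (cong (λ e → (Tℕ ^ᶠ e) α) (+-comm k 1)) ⟩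
    (Tℕ ^ᶠ suc k) α                   ∎
    where open SetoidReasoning ≋-mod-setoid

  orbitSum : ℕ → Vecℕ → ℕ → Vecℕ
  orbitSum Q w zero    i = 0
  orbitSum Q w (suc r) i = (Tℕ ^ᶠ Q) (orbitSum Q w r) i + w i

  orbitSum-≋ : ∀ {D} .{{_ : NonZero D}} Q w → (Tℕ ^ᶠ Q) w ≋ w mod D → ∀ r → orbitSum Q w r ≋ (λ i → r * w i) mod D
  orbitSum-≋ Q w TᵠW≋w zero    i = ≡-mod-refl
  orbitSum-≋ Q w TᵠW≋w (suc r) i = begin
    (Tℕ ^ᶠ Q) (orbitSum Q w r) i + w i      ≈⟨ +-cong-mod (^ᶠ-cong-mod (U-cong-mod 1) Q (orbitSum-≋ Q w TᵠW≋w r) i) ≡-mod-refl ⟩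
    (Tℕ ^ᶠ Q) (λ i → r * w i) i + w i       ≡⟨ cong (_+ w i) (U^-* 1 Q r w i) ⟩
    r * (Tℕ ^ᶠ Q) w i + w i                 ≈⟨ +-cong-mod (*-cong-mod (≡-mod-refl {x = r}) (TᵠW≋w i)) ≡-mod-refl ⟩
    r * w i + w i                           ≡⟨ +-comm (r * w i) (w i) ⟩
    suc r * w i                             ∎
    where open SetoidReasoning ≡-mod-setoid

  -- A subtraction-free form of Tᵠβ ≡ β (mod M), iterated r times.
  Tℕ^[r*Q]-quotients : ∀ M Q β u v → (∀ i → (Tℕ ^ᶠ Q) β i + M * u i ≡ β i + M * v i) →
                       ∀ r i → (Tℕ ^ᶠ (r * Q)) β i + M * orbitSum Q u r i ≡ β i + M * orbitSum Q v r i
  Tℕ^[r*Q]-quotients M Q β u v step zero    i = refl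
  Tℕ^[r*Q]-quotients M Q β u v step (suc r) i = begin
    (Tℕ ^ᶠ (Q + r * Q)) β i + M * ((Tℕ ^ᶠ Q) Su i + u i)
      ≡⟨ cong (λ x → x + M * ((Tℕ ^ᶠ Q) Su i + u i)) (cong-app (^ᶠ-+ Tℕ Q (r * Q) β) i) ⟩
    (Tℕ ^ᶠ Q) A i + M * ((Tℕ ^ᶠ Q) Su i + u i)
      ≡⟨ regroup₁ _ _ _ M ⟩
    ((Tℕ ^ᶠ Q) A i + M * (Tℕ ^ᶠ Q) Su i) + M * u i
      ≡⟨ cong (_+ M * u i) (trans (sym (U^-linear 1 Q A M Su i))
           (trans (U^-cong 1 Q (Tℕ^[r*Q]-quotients M Q β u v step r) i) (U^-linear 1 Q β M Sv i))) ⟩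
    ((Tℕ ^ᶠ Q) β i + M * (Tℕ ^ᶠ Q) Sv i) + M * u i
      ≡⟨ regroup₂ _ _ _ M ⟩
    ((Tℕ ^ᶠ Q) β i + M * u i) + M * (Tℕ ^ᶠ Q) Sv i
      ≡⟨ cong (_+ M * (Tℕ ^ᶠ Q) Sv i) (step i) ⟩
    (β i + M * v i) + M * (Tℕ ^ᶠ Q) Sv i
      ≡⟨ regroup₃ _ _ _ M ⟩
    β i + M * ((Tℕ ^ᶠ Q) Sv i + v i)
      ∎
    where
    open ≡-Reasoning
    A Su Sv : Vecℕ
    A = (Tℕ ^ᶠ (r * Q)) β
    Su = orbitSum Q u r
    Sv = orbitSum Q v r
    regroup₁ : ∀ a b c M → a + M * (b + c) ≡ (a + M * b) + M * c
    regroup₁ = solve-∀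
    regroup₂ : ∀ a b c M → (a + M * b) + M * c ≡ (a + M * c) + M * b
    regroup₂ = solve-∀
    regroup₃ : ∀ a b c M → (a + M * b) + M * c ≡ a + M * (c + b)
    regroup₃ = solve-∀

  module Lifting {p M : ℕ} .{{_ : NonZero p}} .{{_ : NonZero M}} .{{_ : NonZero (p * M)}}
                 (p∣M : p ∣ M) {K Q : ℕ} (periodic : AllPeriodicFrom M K Q) where

    private
      Tᵠ∘Tᴷ≡Tᴷ⁺ᵠ : ∀ γ → (Tℕ ^ᶠ Q) ((Tℕ ^ᶠ K) γ) ≡ (Tℕ ^ᶠ (K + Q)) γ
      Tᵠ∘Tᴷ≡Tᴷ⁺ᵠ γ = trans (^ᶠ-comm Tℕ Q K γ) (sym (^ᶠ-+ Tℕ K Q γ))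

      image-returns : ∀ γ → (Tℕ ^ᶠ Q) ((Tℕ ^ᶠ K) γ) ≋ (Tℕ ^ᶠ K) γ mod p
      image-returns γ i = ≡-mod-∣-weaken p∣M (≡-mod-trans (≡⇒≡-mod (cong-app (Tᵠ∘Tᴷ≡Tᴷ⁺ᵠ γ) i)) (periodic γ K ≤-refl i))

    -- Write Tᵠγ ≡ γ (mod M) as Tᵠγ + M·u = γ + M·v over ℕ and apply Tᴷ. After p returns the corrections
    -- are M times orbit sums of Tᴷu and Tᴷv, which vanish mod p because Tᴷ-images are Q-periodic mod p.
    lift-returns : ∀ γ → (Tℕ ^ᶠ Q) γ ≋ γ mod M → (Tℕ ^ᶠ (p * Q)) ((Tℕ ^ᶠ K) γ) ≋ (Tℕ ^ᶠ K) γ mod (p * M)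
    lift-returns γ Tᵠγ≋γ i = quotients⇒≡-mod {a = quotient (p∣orbitSum u)} {b = quotient (p∣orbitSum v)} (begin
      (Tℕ ^ᶠ (p * Q)) β i + p * M * quotient (p∣orbitSum u)   ≡⟨ cong ((Tℕ ^ᶠ (p * Q)) β i +_) (M*orbitSum≡ u) ⟨
      (Tℕ ^ᶠ (p * Q)) β i + M * orbitSum Q ((Tℕ ^ᶠ K) u) p i  ≡⟨ Tℕ^[r*Q]-quotients M Q β _ _ step p i ⟩
      β i + M * orbitSum Q ((Tℕ ^ᶠ K) v) p i                  ≡⟨ cong (β i +_) (M*orbitSum≡ v) ⟩
      β i + p * M * quotient (p∣orbitSum v)                   ∎)
      where
      open ≡-Reasoning
      β u v : Vecℕ
      β = (Tℕ ^ᶠ K) γ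
      u i = γ i / M
      v i = (Tℕ ^ᶠ Q) γ i / M
      step : ∀ i → (Tℕ ^ᶠ Q) β i + M * (Tℕ ^ᶠ K) u i ≡ β i + M * (Tℕ ^ᶠ K) v i
      step i = begin
        (Tℕ ^ᶠ Q) β i + M * (Tℕ ^ᶠ K) u i                ≡⟨ cong (_+ M * (Tℕ ^ᶠ K) u i) (cong-app (^ᶠ-comm Tℕ Q K γ) i) ⟩
        (Tℕ ^ᶠ K) ((Tℕ ^ᶠ Q) γ) i + M * (Tℕ ^ᶠ K) u i    ≡⟨ U^-linear 1 K ((Tℕ ^ᶠ Q) γ) M u i ⟨
        (Tℕ ^ᶠ K) (λ j → (Tℕ ^ᶠ Q) γ j + M * u j) i      ≡⟨ U^-cong 1 K (λ j → ≡-mod⇒quotients (Tᵠγ≋γ j)) i ⟩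
        (Tℕ ^ᶠ K) (λ j → γ j + M * v j) i                 ≡⟨ U^-linear 1 K γ M v i ⟩
        β i + M * (Tℕ ^ᶠ K) v i                           ∎
      p∣orbitSum : ∀ w → p ∣ orbitSum Q ((Tℕ ^ᶠ K) w) p i
      p∣orbitSum w = ≡0-mod⇒∣ (≡-mod-trans (orbitSum-≋ Q _ (image-returns w) p i) (∣⇒≡0-mod (m∣m*n _)))
      M*orbitSum≡ : ∀ w → M * orbitSum Q ((Tℕ ^ᶠ K) w) p i ≡ p * M * quotient (p∣orbitSum w)
      M*orbitSum≡ w = trans (cong (M *_) (m∣n⇒n≡quotient*m (p∣orbitSum w))) (regroup M _ p)
        where
        regroup : ∀ M c p → M * (c * p) ≡ p * M * c
        regroup = solve-∀

    lift : AllPeriodicFrom (p * M) (K + K) (p * Q)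
    lift α k 2K≤k = begin
      (Tℕ ^ᶠ (k + p * Q)) α              ≡⟨ trans (cong (λ e → (Tℕ ^ᶠ e) α) (+-comm k (p * Q))) (^ᶠ-+ Tℕ (p * Q) k α) ⟩
      (Tℕ ^ᶠ (p * Q)) ((Tℕ ^ᶠ k) α)      ≡⟨ cong (Tℕ ^ᶠ (p * Q)) Tᵏα≡Tᴷγ ⟩
      (Tℕ ^ᶠ (p * Q)) ((Tℕ ^ᶠ K) γ)      ≈⟨ lift-returns γ γ-returns ⟩
      (Tℕ ^ᶠ K) γ                         ≡⟨ Tᵏα≡Tᴷγ ⟨
      (Tℕ ^ᶠ k) α                         ∎
      where
      open SetoidReasoning ≋-mod-setoid
      γ : Vecℕ
      γ = (Tℕ ^ᶠ (k ∸ K)) α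
      Tᵏα≡Tᴷγ : (Tℕ ^ᶠ k) α ≡ (Tℕ ^ᶠ K) γ
      Tᵏα≡Tᴷγ = trans (cong (λ e → (Tℕ ^ᶠ e) α) (sym (m+[n∸m]≡n (m+n≤o⇒m≤o K 2K≤k)))) (^ᶠ-+ Tℕ K (k ∸ K) α)
      γ-returns : (Tℕ ^ᶠ Q) γ ≋ γ mod M
      γ-returns i = ≡-mod-trans
        (≡⇒≡-mod (cong-app (trans (sym (^ᶠ-+ Tℕ Q (k ∸ K) α)) (cong (λ e → (Tℕ ^ᶠ e) α) (+-comm Q (k ∸ K)))) i))
        (periodic α (k ∸ K) (m+n≤o⇒m≤o∸n K 2K≤k) i)

  δ-period⇒2^Q≡1 : ∀ {M} .{{_ : NonZero M}} → Coprime M 2 → ∀ {Q} → Orbit.EventualPeriod M δ Q → 2 ^ Q ≡ 1 mod M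
  δ-period⇒2^Q≡1 {M} M⊥2 {Q} (N , periodic) = ^-*-cancelˡ-mod N M⊥2 (begin
    2 ^ N * 2 ^ Q                ≡⟨ ^-distribˡ-+-* 2 N Q ⟨
    2 ^ (N + Q)                  ≡⟨ ∑-Tℕ^δ (N + Q) ⟨
    sum ((Tℕ ^ᶠ (N + Q)) δ)      ≈⟨ ∑-cong-mod (periodic N ≤-refl) ⟩
    sum ((Tℕ ^ᶠ N) δ)            ≡⟨ ∑-Tℕ^δ N ⟩
    2 ^ N                        ≡⟨ *-identityʳ (2 ^ N) ⟨
    2 ^ N * 1                    ∎)
    where open SetoidReasoning ≡-mod-setoid

module Reduction {m : ℕ} .{{_ : NonZero m}} (n′ : ℕ) where

  open Circulant n′
  open OrbitPeriods n′

  ≗ᵥ-setoid : Setoid _ _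
  ≗ᵥ-setoid = record
    { Carrier = Vecₘ m n
    ; _≈_ = _≗ᵥ_
    ; isEquivalence = record
      { refl = λ _ → refl
      ; sym = λ a≗b i → sym (a≗b i)
      ; trans = λ a≗b b≗c i → trans (a≗b i) (b≗c i)
      }
    }

  T-cong : ∀ {a b : Vecₘ m n} → a ≗ᵥ b → T m n a ≗ᵥ T m n b
  T-cong a≗b i = cong₂ (λ x y → red m (toℕ x + toℕ y)) (a≗b i) (a≗b (nextIx n i))

  module FinOrbit (a : Vecₘ m n) = EventualPeriods ≗ᵥ-setoid (λ k → Tˢ m n k a) T-cong

  toℕ-Tˢ : ∀ k a i → toℕ (Tˢ m n k a i) ≡ (Tℕ ^ᶠ k) (toℕ ∘ a) i mod m
  toℕ-Tˢ zero    a i = ≡-mod-refl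
  toℕ-Tˢ (suc k) a i = ≡-mod-trans (toℕ-red m _) (+-cong-mod (toℕ-Tˢ k a i) (toℕ-Tˢ k a (i ⊕ 1)))

  ≋⇒≗ᵥ : ∀ {a j k} → (Tℕ ^ᶠ j) (toℕ ∘ a) ≋ (Tℕ ^ᶠ k) (toℕ ∘ a) mod m → Tˢ m n j a ≗ᵥ Tˢ m n k a
  ≋⇒≗ᵥ {a} {j} {k} Tʲa≋Tᵏa i = toℕ-≡-mod⇒≡ (≡-mod-trans (toℕ-Tˢ j a i) (≡-mod-trans (Tʲa≋Tᵏa i) (≡-mod-sym (toℕ-Tˢ k a i))))

  ≗ᵥ⇒≋ : ∀ {a j k} → Tˢ m n j a ≗ᵥ Tˢ m n k a → (Tℕ ^ᶠ j) (toℕ ∘ a) ≋ (Tℕ ^ᶠ k) (toℕ ∘ a) mod m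
  ≗ᵥ⇒≋ {a} {j} {k} Tʲa≗Tᵏa i = ≡-mod-trans (≡-mod-sym (toℕ-Tˢ j a i)) (≡-mod-trans (≡⇒≡-mod (cong toℕ (Tʲa≗Tᵏa i))) (toℕ-Tˢ k a i))

  periodicFrom-toℕ⇒ : ∀ {a K Q} → Orbit.PeriodicFrom m (toℕ ∘ a) K Q → FinOrbit.PeriodicFrom a K Q
  periodicFrom-toℕ⇒ {a} {K} {Q} periodic k K≤k = ≋⇒≗ᵥ {a} {k + Q} {k} (periodic k K≤k)

  ⇒periodicFrom-toℕ : ∀ {a K Q} → FinOrbit.PeriodicFrom a K Q → Orbit.PeriodicFrom m (toℕ ∘ a) K Q
  ⇒periodicFrom-toℕ {a} {K} {Q} periodic k K≤k = ≗ᵥ⇒≋ {a} {k + Q} {k} (periodic k K≤k)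

  δₘ : Vecₘ m n
  δₘ i = red m (δ i)

  module _ (1<m : 1 < m) where

    toℕ∘δₘ≗δ : toℕ ∘ δₘ ≗ δ
    toℕ∘δₘ≗δ i = trans (Fin.toℕ-fromℕ< _) (m<n⇒m%n≡m (≤-<-trans (δ≤1 i) 1<m))
      where
      δ≤1 : ∀ i → δ i ≤ 1
      δ≤1 Fin.zero    = ≤-refl
      δ≤1 (Fin.suc _) = z≤n

    δₘ-periodicFrom⇒δ : ∀ {K Q} → FinOrbit.PeriodicFrom δₘ K Q → Orbit.PeriodicFrom m δ K Q
    δₘ-periodicFrom⇒δ periodic k K≤k i = ≡-mod-trans (≡⇒≡-mod (sym (U^-cong 1 (k + _) toℕ∘δₘ≗δ i)))
      (≡-mod-trans (⇒periodicFrom-toℕ periodic k K≤k i) (≡⇒≡-mod (U^-cong 1 k toℕ∘δₘ≗δ i)))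

    -- δₘ attains the cycle length R, and every cycle length divides the common period R.
    isPeriod-intro : ∀ {K R} → 0 < R → AllPeriodicFrom m K R →
                     (∀ {Q} → 0 < Q → Orbit.EventualPeriod m δ Q → R ∣ Q) → IsPeriod m n R
    isPeriod-intro {K} {R} 0<R periodic R∣δ-periods =
      (δₘ , 0<R , (K , periodicFrom-toℕ⇒ (periodic _)) ,
        λ Q 0<Q Q<R (N , δₘ-periodic) → <⇒≱ Q<R (∣⇒≤ {{>-nonZero 0<Q}} (R∣δ-periods 0<Q (N , δₘ-periodicFrom⇒δ δₘ-periodic)))) ,
      λ a Q a-cycle → ∣⇒≤ {{>-nonZero 0<R}} (FinOrbit.cycleLength-∣ a a-cycle 0<R (K , periodicFrom-toℕ⇒ (periodic _)))

module Proposition {p : ℕ} .{{_ : NonZero p}} (p-prime : Prime p) (2<p : 2 < p) (non-wieferich : ¬ IsWieferich p)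
                   (n′ : ℕ) (p∤n : ¬ p ∣ suc n′) {P : ℕ} (P-period : IsPeriod p (suc n′) P) where

  open NonWieferich p-prime 2<p non-wieferich
  open Circulant n′
  open OrbitPeriods n′
  module Rₚ = Reduction {p} n′

  private
    instance
      p¹≢0 : NonZero (p ^ 1)
      p¹≢0 = m^n≢0 p 1

    1<p : 1 < p
    1<p = <-trans (s<s z<s) 2<p

    a₀ : Vecₘ p n
    a₀ = proj₁ (proj₁ P-period)

    a₀-cycle : Rₚ.FinOrbit.CycleLength a₀ P
    a₀-cycle = proj₂ (proj₁ P-period)

    order : ∃[ d ] 0 < d × p ^ d ≡ 1 mod n
    order = ^≡1-mod-exists (Coprime.sym (prime∤⇒coprime p-prime p∤n))

    d E : ℕ
    d = proj₁ order
    E = p ^ d ∸ 1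

    0<E : 0 < E
    0<E = m<n⇒0<n∸m (≤-trans 1<p (subst (_≤ p ^ d) (*-identityʳ p) (^-monoʳ-≤ p (proj₁ (proj₂ order)))))

    E-periodic : AllPeriodicFrom p 1 E
    E-periodic = Tℕ-periodicFrom-1 {p} {d} p-prime (proj₂ (proj₂ order))

    P∣δ-period : ∀ {M} .{{_ : NonZero M}} {Q} → p ∣ M → 0 < Q → Orbit.EventualPeriod M δ Q → P ∣ Q
    P∣δ-period p∣M 0<Q (N , δ-periodic) = Rₚ.FinOrbit.cycleLength-∣ a₀ a₀-cycle 0<Q
      (N , Rₚ.periodicFrom-toℕ⇒ (δ-periodicFrom⇒all (periodicFrom-∣-weaken p∣M δ-periodic) _))

    -- The cycle length L of δ is at most P by maximality and a multiple of P, so δ is P-periodic.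
    δ-cycle : ∃ (Rₚ.FinOrbit.CycleLength (Rₚ.δₘ))
    δ-cycle = Rₚ.FinOrbit.cycleLength-exists Rₚ.δₘ (λ a b → Fin.all? (λ i → a i Fin.≟ b i)) 0<E
      (Rₚ.periodicFrom-toℕ⇒ (E-periodic _))

    L : ℕ
    L = proj₁ δ-cycle

    δ-L-periodic : Orbit.EventualPeriod p δ L
    δ-L-periodic = proj₁ (proj₁ (proj₂ (proj₂ δ-cycle))) ,
      Rₚ.δₘ-periodicFrom⇒δ 1<p (proj₂ (proj₁ (proj₂ (proj₂ δ-cycle))))

    L≡P : L ≡ P
    L≡P = ≤-antisym (proj₂ P-period Rₚ.δₘ L (proj₂ δ-cycle))
      (∣⇒≤ {{>-nonZero (proj₁ (proj₂ δ-cycle))}} (P∣δ-period ∣-refl (proj₁ (proj₂ δ-cycle)) δ-L-periodic))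

    N : ℕ
    N = proj₁ δ-L-periodic

    P-periodic : AllPeriodicFrom (p ^ 1) N P
    P-periodic = δ-periodicFrom⇒all (periodicFrom-∣-weaken (∣-reflexive (*-identityʳ p))
      (subst (Orbit.PeriodicFrom p δ _) L≡P (proj₂ δ-L-periodic)))

    0<P : 0 < P
    0<P = subst (0 <_) L≡P (proj₁ (proj₂ δ-cycle))

    p⊥P : Coprime p P
    p⊥P = prime∤⇒coprime p-prime λ p∣P → <⇒≢ 1<p (sym (∣1⇒≡1 (p∣1 (∣-trans p∣P P∣E))))
      where
      P∣E : P ∣ E
      P∣E = Rₚ.FinOrbit.cycleLength-∣ a₀ a₀-cycle 0<E (1 , Rₚ.periodicFrom-toℕ⇒ (E-periodic _))
      p∣1 : p ∣ E → p ∣ 1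
      p∣1 p∣E = ∣m+n∣m⇒∣n (subst (p ∣_) (sym (m∸n+n≡m (m^n>0 p d))) p∣p^d) p∣E
        where
        p∣p^d : p ∣ p ^ d
        p∣p^d = subst (λ e → p ∣ p ^ e) (suc-pred d {{>-nonZero (proj₁ (proj₂ order))}}) (m∣m*n (p ^ pred d))

    p²-periodic : AllPeriodicFrom (p ^ 2) (N + N) (p * P)
    p²-periodic = Lifting.lift {p} {p ^ 1} (∣-reflexive (sym (*-identityʳ p))) P-periodic
    p³-periodic : AllPeriodicFrom (p ^ 3) (N + N + (N + N)) (p * (p * P))
    p³-periodic = Lifting.lift {p} {p ^ 2} (m∣m*n (p ^ 1)) p²-periodic

    p*[p*P]≡p²*P : p * (p * P) ≡ p ^ 2 * P
    p*[p*P]≡p²*P = sym (trans (*-assoc p (p ^ 1) P) (cong (λ x → p * (x * P)) (*-identityʳ p)))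

    1<p^[1+k] : ∀ k → 1 < p ^ suc k
    1<p^[1+k] k = <-≤-trans 1<p (m≤m*n p (p ^ k) {{m^n≢0 p k}})

  period-p² : IsPeriod (p ^ 2) n (p * P)
  period-p² = Reduction.isPeriod-intro n′ (1<p^[1+k] 1) (≤-trans 0<P (m≤n*m P p)) p²-periodic λ 0<Q δ-periodic →
    coprime-∣-* p⊥P (2^e≡1-mod-p²⇒p∣e (δ-period⇒2^Q≡1 (coprime-p^k-2 2) δ-periodic)) (P∣δ-period (m∣m*n (p ^ 1)) 0<Q δ-periodic)

  period-p³ : IsPeriod (p ^ 3) n (p ^ 2 * P)
  period-p³ = Reduction.isPeriod-intro n′ (1<p^[1+k] 2) (≤-trans 0<P (m≤n*m P (p ^ 2)))
    (subst (AllPeriodicFrom (p ^ 3) _) p*[p*P]≡p²*P p³-periodic) λ 0<Q δ-periodic →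
    coprime-∣-* (coprime-^ˡ 2 p⊥P) (2^e≡1-mod-p³⇒p²∣e (δ-period⇒2^Q≡1 (coprime-p^k-2 3) δ-periodic))
      (P∣δ-period (m∣m*n (p ^ 2)) 0<Q δ-periodic)

proposition5p3 : (p : ℕ) → .{{_ : NonZero p}} → Prime p → 2 < p → ¬ IsWieferich p
                 → (n : ℕ) → .{{_ : NonZero n}} → ¬ (p ∣ n)
                 → (P : ℕ) → IsPeriod p n P
                 → IsPeriod (p ^ 2) {{m^n≢0 p 2}} n (p * P) × IsPeriod (p ^ 3) {{m^n≢0 p 3}} n (p ^ 2 * P)
proposition5p3 p p-prime 2<p non-wieferich (suc n′) p∤n P P-period = period-p² , period-p³
  where open Proposition p-prime 2<p non-wieferich n′ p∤n P-period
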